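{- Let $a,b$ be positive integers with $\gcd(a,b)=1$. A lattice point $(r,s)\in\mathbb{N}\times\mathbb{N}$ is $(b/a)$-visible if and only if $s=nr^{b/a}$ for some $n\in\mathbb{Q}$, $r=\ell^a$ for some $\ell\in\mathbb{N}$, and $(\ell,s)$ is $b$-visible.
   Context: $\mathbb{N}=\{1,2,3,\ldots\}$. For a rational $c>0$, a point $(r,s)\in\mathbb{N}\times\mathbb{N}$ is $c$-visible if it lies on the graph of $f(x)=nx^{c}$ for some $n\in\mathbb{Q}$ and there is no other point of $\mathbb{N}\times\mathbb{N}$ on the graph of $f$ lying between $(0,0)$ and $(r,s)$ (i.e. no $(r',s')\in\mathbb{N}\times\mathbb{N}$ with $s'=f(r')$ and $0<r'<r$). In particular this defines both $(b/a)$-visibility and, for the integer $b$, $b$-visibility. -}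

module Defs where

open import Data.Nat using (ℕ; zero; suc; _<_)
open import Data.Integer using (+_)
open import Data.Rational using (ℚ; 1ℚ; 0ℚ; _*_; _/_) renaming (_<_ to _<ℚ_)
open import Data.Product using (Σ; _×_)
open import Relation.Binary.PropositionalEquality using (_≡_)
open import Relation.Nullary using (¬_)

_^ℚ_ : ℚ → ℕ → ℚ
q ^ℚ zero  = 1ℚ
q ^ℚ suc k = q * (q ^ℚ k)

ℕ→ℚ : ℕ → ℚ
ℕ→ℚ m = + m / 1

-- The exponent c = b / a (a ≥ 1) is represented by the pair (a , b).
-- (r , s) lies on the graph of f(x) = n x^(b/a), i.e. s = n · r^(b/a).
-- For r, s > 0 this real equation holds iff n > 0 and s^a = n^a · r^b
-- (the a-th power is injective on positive reals), which is what we use.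
OnGraph : (a b : ℕ) → ℚ → ℕ → ℕ → Set
OnGraph a b n r s = (0ℚ <ℚ n) × (ℕ→ℚ s ^ℚ a ≡ (n ^ℚ a) * (ℕ→ℚ r ^ℚ b))

Visible : (a b : ℕ) → ℕ → ℕ → Set
Visible a b r s =
  Σ ℚ λ n → OnGraph a b n r s ×
    ((r′ s′ : ℕ) → 0 < r′ → 0 < s′ → r′ < r → ¬ OnGraph a b n r′ s′)

{-# OPTIONS --safe #-}
-- (r, s) lies on y = n·x^(b/a) iff w = s/n satisfies wᵃ = rᵇ. As gcd(a, b) = 1, Bézout turns this into
-- r = zᵃ for a rational z, and a rational whose a-th power is a natural number is itself a natural
-- number ℓ. For r = ℓᵃ the condition sᵃ = nᵃ(ℓᵃ)ᵇ is just s = n·ℓᵇ, i.e. (ℓ, s) lies on y = n·xᵇ.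
-- So for a fixed n the lattice points of the two graphs correspond under ℓ ↦ ℓᵃ, which is strictly
-- increasing, and the first point on one graph corresponds to the first point on the other.
module Submission where

open import Defs
open import Algebra.Bundles using (CommutativeRing; CommutativeMonoid)
open import Data.Nat as ℕ using (ℕ; zero; suc; _<_; _^_; z<s)
import Data.Nat.Properties as ℕ
open import Data.Nat.Divisibility using (_∣_; ∣1⇒≡1; m∣m*n; ∣n⇒∣m*n)
open import Data.Nat.Coprimality as Coprime using (Coprime; 1-coprimeTo; coprime-divisor; coprime-Bézout; gcd≡1⇒coprime; recompute)
open import Data.Nat.GCD using (gcd; module Bézout)
open import Data.Integer as ℤ using (+_)
import Data.Integer.Properties as ℤ
open import Data.Rational using (ℚ; mkℚ; 0ℚ; 1ℚ; _*_; _/_; _÷_; 1/_; toℚᵘ; NonZero; Positive; positive) renaming (_<_ to _<ℚ_)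
open import Data.Rational.Properties
open import Data.Rational.Unnormalised as ℚᵘ using (mkℚᵘ; ↥_; ↧_; ↧ₙ_; _≃_)
import Data.Rational.Unnormalised.Properties as ℚᵘ
open import Data.Product using (Σ; ∃-syntax; _×_; _,_)
open import Function.Bundles using (_⇔_; mk⇔; Equivalence)
open import Relation.Binary.Definitions using (tri<; tri≈; tri>)
open import Relation.Binary.PropositionalEquality
open import Relation.Nullary using (¬_; contradiction)

import Algebra.Properties.CommutativeSemiring.Exp (CommutativeRing.commutativeSemiring +-*-commutativeRing) as ℚExp
import Algebra.Properties.CommutativeSemigroup (CommutativeMonoid.commutativeSemigroup *-1-commutativeMonoid) as ℚ*
open import Algebra.Definitions.RawSemiring ℚᵘ.+-*-rawSemiring using () renaming (_^_ to _^ᵘ_)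

open ≡-Reasoning

m^n>0⇒m>0 : ∀ m n .{{_ : ℕ.NonZero n}} → 0 < m ^ n → 0 < m
m^n>0⇒m>0 (suc m) n       _  = z<s
m^n>0⇒m>0 zero    (suc n) ()

^-cancelˡ-< : ∀ n {m o} → m ^ n < o ^ n → m < o
^-cancelˡ-< n mⁿ<oⁿ = ℕ.≰⇒> (λ o≤m → ℕ.<⇒≱ mⁿ<oⁿ (ℕ.^-monoˡ-≤ n o≤m))

coprime∧∣^⇒≡1 : ∀ {d m} n → Coprime d m → d ∣ m ^ n → d ≡ 1
coprime∧∣^⇒≡1 zero    _   d∣1    = ∣1⇒≡1 d∣1
coprime∧∣^⇒≡1 (suc n) d⊥m d∣m·mⁿ = coprime∧∣^⇒≡1 n d⊥m (coprime-divisor d⊥m d∣m·mⁿ)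

^ℚ≡^ : ∀ x n → x ^ℚ n ≡ x ℚExp.^ n
^ℚ≡^ x zero    = refl
^ℚ≡^ x (suc n) = cong (x *_) (^ℚ≡^ x n)

^ℚ-assocʳ : ∀ x m n → (x ^ℚ m) ^ℚ n ≡ x ^ℚ (m ℕ.* n)
^ℚ-assocʳ x m n rewrite ^ℚ≡^ (x ^ℚ m) n | ^ℚ≡^ x m | ^ℚ≡^ x (m ℕ.* n) = ℚExp.^-assocʳ x m n

^ℚ-comm : ∀ x m n → (x ^ℚ m) ^ℚ n ≡ (x ^ℚ n) ^ℚ m
^ℚ-comm x m n = begin
  (x ^ℚ m) ^ℚ n   ≡⟨ ^ℚ-assocʳ x m n ⟩
  x ^ℚ (m ℕ.* n)  ≡⟨ cong (x ^ℚ_) (ℕ.*-comm m n) ⟩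
  x ^ℚ (n ℕ.* m)  ≡⟨ ^ℚ-assocʳ x n m ⟨
  (x ^ℚ n) ^ℚ m   ∎

^ℚ-distrib-* : ∀ x y n → (x * y) ^ℚ n ≡ x ^ℚ n * y ^ℚ n
^ℚ-distrib-* x y n rewrite ^ℚ≡^ (x * y) n | ^ℚ≡^ x n | ^ℚ≡^ y n = ℚExp.^-distrib-* x y n

^ℚ-zeroˡ : ∀ n → 1ℚ ^ℚ n ≡ 1ℚ
^ℚ-zeroˡ zero    = refl
^ℚ-zeroˡ (suc n) = trans (*-identityˡ _) (^ℚ-zeroˡ n)

^ℚ-pos : ∀ x .{{_ : Positive x}} n → Positive (x ^ℚ n)
^ℚ-pos x zero    = _
^ℚ-pos x (suc n) = pos*pos⇒pos x (x ^ℚ n) {{^ℚ-pos x n}}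

^ℚ-monoˡ-< : ∀ n .{{_ : ℕ.NonZero n}} {x y} .{{_ : Positive x}} .{{_ : Positive y}} →
             x <ℚ y → x ^ℚ n <ℚ y ^ℚ n
^ℚ-monoˡ-< (suc zero)          x<y = *-monoˡ-<-pos 1ℚ x<y
^ℚ-monoˡ-< (suc n@(suc _)) {x} {y} x<y = <-trans
  (*-monoˡ-<-pos (x ^ℚ n) {{^ℚ-pos x n}} x<y)
  (*-monoʳ-<-pos y (^ℚ-monoˡ-< n x<y))

^ℚ-injectiveˡ : ∀ n .{{_ : ℕ.NonZero n}} {x y} .{{_ : Positive x}} .{{_ : Positive y}} →
                x ^ℚ n ≡ y ^ℚ n → x ≡ y
^ℚ-injectiveˡ n {x} {y} xⁿ≡yⁿ with <-cmp x y
... | tri< x<y _ _ = contradiction xⁿ≡yⁿ (<⇒≢ (^ℚ-monoˡ-< n x<y))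
... | tri≈ _ x≡y _ = x≡y
... | tri> _ _ y<x = contradiction (sym xⁿ≡yⁿ) (<⇒≢ (^ℚ-monoˡ-< n y<x))

x^n≡y^n*z⇒[x÷y]^n≡z : ∀ {x y z} n .{{_ : NonZero y}} → x ^ℚ n ≡ y ^ℚ n * z → (x ÷ y) ^ℚ n ≡ z
x^n≡y^n*z⇒[x÷y]^n≡z {x} {y} {z} n xⁿ≡yⁿz = begin
  (x * 1/ y) ^ℚ n               ≡⟨ ^ℚ-distrib-* x (1/ y) n ⟩
  x ^ℚ n * (1/ y) ^ℚ n          ≡⟨ cong (_* (1/ y) ^ℚ n) xⁿ≡yⁿz ⟩
  y ^ℚ n * z * (1/ y) ^ℚ n      ≡⟨ ℚ*.xy∙z≈xz∙y (y ^ℚ n) z _ ⟩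
  y ^ℚ n * (1/ y) ^ℚ n * z      ≡⟨ cong (_* z) (^ℚ-distrib-* y (1/ y) n) ⟨
  (y * 1/ y) ^ℚ n * z           ≡⟨ cong (λ w → w ^ℚ n * z) (*-inverseʳ y) ⟩
  1ℚ ^ℚ n * z                   ≡⟨ cong (_* z) (^ℚ-zeroˡ n) ⟩
  1ℚ * z                        ≡⟨ *-identityˡ z ⟩
  z                             ∎

ℕ→ℚ≡mkℚ : ∀ m → ℕ→ℚ m ≡ mkℚ (+ m) 0 (Coprime.sym (1-coprimeTo m))
ℕ→ℚ≡mkℚ m = normalize-coprime (Coprime.sym (1-coprimeTo m))

ℕ→ℚ-* : ∀ m n → ℕ→ℚ (m ℕ.* n) ≡ ℕ→ℚ m * ℕ→ℚ n
ℕ→ℚ-* m n = begin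
  + (m ℕ.* n) / 1       ≡⟨ cong (_/ 1) (ℤ.pos-* m n) ⟩
  (+ m ℤ.* + n) / 1     ≡⟨ cong₂ _*_ (ℕ→ℚ≡mkℚ m) (ℕ→ℚ≡mkℚ n) ⟨
  ℕ→ℚ m * ℕ→ℚ n         ∎

ℕ→ℚ-^ : ∀ m n → ℕ→ℚ (m ^ n) ≡ ℕ→ℚ m ^ℚ n
ℕ→ℚ-^ m zero    = refl
ℕ→ℚ-^ m (suc n) = trans (ℕ→ℚ-* m (m ^ n)) (cong (ℕ→ℚ m *_) (ℕ→ℚ-^ m n))

ℕ→ℚ-pos : ∀ {m} → 0 < m → Positive (ℕ→ℚ m)
ℕ→ℚ-pos {suc m} _ = normalize-pos (suc m) 1

-- In ℚᵘ nothing is cancelled, so (N/D)ⁿ has numerator Nⁿ and denominator Dⁿ on the nose.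
toℚᵘ-homo-^ : ∀ x n → toℚᵘ (x ^ℚ n) ≃ toℚᵘ x ^ᵘ n
toℚᵘ-homo-^ x zero    = ℚᵘ.≃-refl
toℚᵘ-homo-^ x (suc n) = ℚᵘ.≃-trans (toℚᵘ-homo-* x (x ^ℚ n)) (ℚᵘ.*-congˡ {toℚᵘ x} (toℚᵘ-homo-^ x n))

↥ᵘ-* : ∀ p q → ↥ (p ℚᵘ.* q) ≡ ↥ p ℤ.* ↥ q
↥ᵘ-* (mkℚᵘ _ _) (mkℚᵘ _ _) = refl

↧ₙᵘ-* : ∀ p q → ↧ₙ (p ℚᵘ.* q) ≡ ↧ₙ p ℕ.* ↧ₙ q
↧ₙᵘ-* (mkℚᵘ _ _) (mkℚᵘ _ _) = refl

∣↥ᵘ-^∣ : ∀ p n → ℤ.∣ ↥ (p ^ᵘ n) ∣ ≡ ℤ.∣ ↥ p ∣ ^ n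
∣↥ᵘ-^∣ p zero    = refl
∣↥ᵘ-^∣ p (suc n) = begin
  ℤ.∣ ↥ (p ℚᵘ.* p ^ᵘ n) ∣          ≡⟨ cong ℤ.∣_∣ (↥ᵘ-* p (p ^ᵘ n)) ⟩
  ℤ.∣ ↥ p ℤ.* ↥ (p ^ᵘ n) ∣         ≡⟨ ℤ.abs-* (↥ p) (↥ (p ^ᵘ n)) ⟩
  ℤ.∣ ↥ p ∣ ℕ.* ℤ.∣ ↥ (p ^ᵘ n) ∣   ≡⟨ cong (ℤ.∣ ↥ p ∣ ℕ.*_) (∣↥ᵘ-^∣ p n) ⟩
  ℤ.∣ ↥ p ∣ ^ suc n                ∎

↧ₙᵘ-^ : ∀ p n → ↧ₙ (p ^ᵘ n) ≡ ↧ₙ p ^ n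
↧ₙᵘ-^ p zero    = refl
↧ₙᵘ-^ p (suc n) = trans (↧ₙᵘ-* p (p ^ᵘ n)) (cong (↧ₙ p ℕ.*_) (↧ₙᵘ-^ p n))

x^n≡m⇒m≡ℓ^n : ∀ n .{{_ : ℕ.NonZero n}} x m → x ^ℚ n ≡ ℕ→ℚ m → ∃[ ℓ ] m ≡ ℓ ^ n
x^n≡m⇒m≡ℓ^n n@(suc k) x@(mkℚ N d-1 N⊥D) m xⁿ≡m = ℤ.∣ N ∣ , (begin
  m                ≡⟨ ℕ.*-identityʳ m ⟨
  m ℕ.* 1          ≡⟨ cong (m ℕ.*_) (ℕ.^-zeroˡ n) ⟨
  m ℕ.* 1 ^ n      ≡⟨ cong (λ e → m ℕ.* e ^ n) D≡1 ⟨
  m ℕ.* D ^ n      ≡⟨ Nⁿ≡mDⁿ ⟨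
  ℤ.∣ N ∣ ^ n      ∎)
  where
  D = suc d-1
  P = mkℚᵘ N d-1 ^ᵘ n
  P≃m : P ≃ mkℚᵘ (+ m) 0
  P≃m = ℚᵘ.≃-trans (ℚᵘ.≃-sym (toℚᵘ-homo-^ x n)) (toℚᵘ-cong (trans xⁿ≡m (ℕ→ℚ≡mkℚ m)))
  Nⁿ≡mDⁿ : ℤ.∣ N ∣ ^ n ≡ m ℕ.* D ^ n
  Nⁿ≡mDⁿ = begin
    ℤ.∣ N ∣ ^ n              ≡⟨ ∣↥ᵘ-^∣ (mkℚᵘ N d-1) n ⟨
    ℤ.∣ ↥ P ∣                ≡⟨ cong ℤ.∣_∣ (trans (sym (ℤ.*-identityʳ (↥ P))) (ℚᵘ.drop-*≡* P≃m)) ⟩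
    ℤ.∣ + m ℤ.* ↧ P ∣        ≡⟨ ℤ.abs-* (+ m) (↧ P) ⟩
    m ℕ.* ↧ₙ P               ≡⟨ cong (m ℕ.*_) (↧ₙᵘ-^ (mkℚᵘ N d-1) n) ⟩
    m ℕ.* D ^ n              ∎
  D∣Nⁿ : D ∣ ℤ.∣ N ∣ ^ n
  D∣Nⁿ = subst (D ∣_) (sym Nⁿ≡mDⁿ) (∣n⇒∣m*n m (m∣m*n (D ^ k)))
  D≡1 : D ≡ 1
  D≡1 = coprime∧∣^⇒≡1 n (Coprime.sym (recompute N⊥D)) D∣Nⁿ

-- Bézout gives ia − jb = ±1, whence z = yⁱ/xʲ or z = xʲ/yⁱ.
x^a≡y^b⇒y≡z^a : ∀ {a b} x y .{{_ : Positive x}} .{{_ : Positive y}} →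
                gcd a b ≡ 1 → x ^ℚ a ≡ y ^ℚ b → ∃[ z ] z ^ℚ a ≡ y
x^a≡y^b⇒y≡z^a {a} {b} x y gcd≡1 xᵃ≡yᵇ with coprime-Bézout (gcd≡1⇒coprime gcd≡1)
... | Bézout.+- i j 1+jb≡ia = y ^ℚ i ÷ x ^ℚ j , x^n≡y^n*z⇒[x÷y]^n≡z a (begin
  (y ^ℚ i) ^ℚ a            ≡⟨ ^ℚ-assocʳ y i a ⟩
  y ^ℚ (i ℕ.* a)           ≡⟨ cong (y ^ℚ_) 1+jb≡ia ⟨
  y * y ^ℚ (j ℕ.* b)       ≡⟨ cong (y *_) (^ℚ-assocʳ y j b) ⟨
  y * (y ^ℚ j) ^ℚ b        ≡⟨ cong (y *_) (^ℚ-comm y j b) ⟩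
  y * (y ^ℚ b) ^ℚ j        ≡⟨ cong (λ e → y * e ^ℚ j) xᵃ≡yᵇ ⟨
  y * (x ^ℚ a) ^ℚ j        ≡⟨ cong (y *_) (^ℚ-comm x a j) ⟩
  y * (x ^ℚ j) ^ℚ a        ≡⟨ *-comm y _ ⟩
  (x ^ℚ j) ^ℚ a * y        ∎)
  where
  instance
    xʲ≢0 : NonZero (x ^ℚ j)
    xʲ≢0 = pos⇒nonZero (x ^ℚ j) {{^ℚ-pos x j}}
... | Bézout.-+ i j 1+ia≡jb = x ^ℚ j ÷ y ^ℚ i , x^n≡y^n*z⇒[x÷y]^n≡z a (begin
  (x ^ℚ j) ^ℚ a            ≡⟨ ^ℚ-comm x j a ⟩
  (x ^ℚ a) ^ℚ j            ≡⟨ cong (_^ℚ j) xᵃ≡yᵇ ⟩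
  (y ^ℚ b) ^ℚ j            ≡⟨ ^ℚ-comm y b j ⟩
  (y ^ℚ j) ^ℚ b            ≡⟨ ^ℚ-assocʳ y j b ⟩
  y ^ℚ (j ℕ.* b)           ≡⟨ cong (y ^ℚ_) 1+ia≡jb ⟨
  y * y ^ℚ (i ℕ.* a)       ≡⟨ cong (y *_) (^ℚ-assocʳ y i a) ⟨
  y * (y ^ℚ i) ^ℚ a        ≡⟨ *-comm y _ ⟩
  (y ^ℚ i) ^ℚ a * y        ∎)
  where
  instance
    yⁱ≢0 : NonZero (y ^ℚ i)
    yⁱ≢0 = pos⇒nonZero (y ^ℚ i) {{^ℚ-pos y i}}

OnGraph⇒perfect-power : ∀ a .{{_ : ℕ.NonZero a}} b {n r s} → gcd a b ≡ 1 → 0 < r → 0 < s →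
                        OnGraph a b n r s → ∃[ ℓ ] r ≡ ℓ ^ a
OnGraph⇒perfect-power a b {n} {r} {s} gcd≡1 0<r 0<s (0<n , sᵃ≡nᵃrᵇ) =
  let z , zᵃ≡r = x^a≡y^b⇒y≡z^a {a} {b} (ℕ→ℚ s ÷ n) (ℕ→ℚ r) gcd≡1 (x^n≡y^n*z⇒[x÷y]^n≡z a sᵃ≡nᵃrᵇ)
  in x^n≡m⇒m≡ℓ^n a z r zᵃ≡r
  where
  instance
    n>0 : Positive n
    n>0 = positive 0<n
    n≢0 : NonZero n
    n≢0 = pos⇒nonZero n
    r>0 : Positive (ℕ→ℚ r)
    r>0 = ℕ→ℚ-pos 0<r
    s÷n>0 : Positive (ℕ→ℚ s ÷ n)
    s÷n>0 = pos*pos⇒pos (ℕ→ℚ s) {{ℕ→ℚ-pos 0<s}} (1/ n) {{1/pos⇒pos n}}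

OnGraph-1⇔ : ∀ b n ℓ s → OnGraph 1 b n ℓ s ⇔ (0ℚ <ℚ n × ℕ→ℚ s ≡ n * ℕ→ℚ ℓ ^ℚ b)
OnGraph-1⇔ b n ℓ s = mk⇔
  (λ (0<n , s¹≡n¹ℓᵇ) → 0<n , subst₂ ≡·ℓᵇ (*-identityʳ _) (*-identityʳ n) s¹≡n¹ℓᵇ)
  (λ (0<n , s≡nℓᵇ) → 0<n , subst₂ ≡·ℓᵇ (sym (*-identityʳ _)) (sym (*-identityʳ n)) s≡nℓᵇ)
  where
  ≡·ℓᵇ : ℚ → ℚ → Set
  ≡·ℓᵇ u v = u ≡ v * ℕ→ℚ ℓ ^ℚ b

[nℓᵇ]^a≡nᵃ[ℓᵃ]ᵇ : ∀ a b n ℓ → (n * ℕ→ℚ ℓ ^ℚ b) ^ℚ a ≡ n ^ℚ a * ℕ→ℚ (ℓ ^ a) ^ℚ b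
[nℓᵇ]^a≡nᵃ[ℓᵃ]ᵇ a b n ℓ = begin
  (n * ℕ→ℚ ℓ ^ℚ b) ^ℚ a          ≡⟨ ^ℚ-distrib-* n _ a ⟩
  n ^ℚ a * (ℕ→ℚ ℓ ^ℚ b) ^ℚ a     ≡⟨ cong (n ^ℚ a *_) (^ℚ-comm (ℕ→ℚ ℓ) b a) ⟩
  n ^ℚ a * (ℕ→ℚ ℓ ^ℚ a) ^ℚ b     ≡⟨ cong (λ e → n ^ℚ a * e ^ℚ b) (ℕ→ℚ-^ ℓ a) ⟨
  n ^ℚ a * ℕ→ℚ (ℓ ^ a) ^ℚ b      ∎

OnGraph-1⇒OnGraph-^ : ∀ a b {n} ℓ s → OnGraph 1 b n ℓ s → OnGraph a b n (ℓ ^ a) s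
OnGraph-1⇒OnGraph-^ a b {n} ℓ s onGraph with Equivalence.to (OnGraph-1⇔ b n ℓ s) onGraph
... | 0<n , s≡nℓᵇ = 0<n , trans (cong (_^ℚ a) s≡nℓᵇ) ([nℓᵇ]^a≡nᵃ[ℓᵃ]ᵇ a b n ℓ)

OnGraph-^⇒OnGraph-1 : ∀ a .{{_ : ℕ.NonZero a}} b {n ℓ s} → 0 < ℓ → 0 < s →
                      OnGraph a b n (ℓ ^ a) s → OnGraph 1 b n ℓ s
OnGraph-^⇒OnGraph-1 a b {n} {ℓ} {s} 0<ℓ 0<s (0<n , sᵃ≡nᵃ[ℓᵃ]ᵇ) =
  Equivalence.from (OnGraph-1⇔ b n ℓ s)
    (0<n , ^ℚ-injectiveˡ a (trans sᵃ≡nᵃ[ℓᵃ]ᵇ (sym ([nℓᵇ]^a≡nᵃ[ℓᵃ]ᵇ a b n ℓ))))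
  where
  instance
    s>0 : Positive (ℕ→ℚ s)
    s>0 = ℕ→ℚ-pos 0<s
    nℓᵇ>0 : Positive (n * ℕ→ℚ ℓ ^ℚ b)
    nℓᵇ>0 = pos*pos⇒pos n {{positive 0<n}} _ {{^ℚ-pos (ℕ→ℚ ℓ) {{ℕ→ℚ-pos 0<ℓ}} b}}

Visible-^⇒Visible-1 : ∀ a .{{_ : ℕ.NonZero a}} b {ℓ s} → 0 < ℓ → 0 < s →
                      Visible a b (ℓ ^ a) s → Visible 1 b ℓ s
Visible-^⇒Visible-1 a b 0<ℓ 0<s (n , onGraph , first) =
  n , OnGraph-^⇒OnGraph-1 a b 0<ℓ 0<s onGraph ,
  λ ℓ′ s′ 0<ℓ′ 0<s′ ℓ′<ℓ onGraph′ →
    first (ℓ′ ^ a) s′ (ℕ.m^n>0 ℓ′ {{ℕ.>-nonZero 0<ℓ′}} a) 0<s′ (ℕ.^-monoˡ-< a ℓ′<ℓ)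
          (OnGraph-1⇒OnGraph-^ a b ℓ′ s′ onGraph′)

Visible-1⇒Visible-^ : ∀ a .{{_ : ℕ.NonZero a}} b {ℓ s} → gcd a b ≡ 1 →
                      Visible 1 b ℓ s → Visible a b (ℓ ^ a) s
Visible-1⇒Visible-^ a b {ℓ} {s} gcd≡1 (n , onGraph , first) =
  n , OnGraph-1⇒OnGraph-^ a b ℓ s onGraph , first′
  where
  first′ : (r′ s′ : ℕ) → 0 < r′ → 0 < s′ → r′ < ℓ ^ a → ¬ OnGraph a b n r′ s′
  first′ r′ s′ 0<r′ 0<s′ r′<ℓᵃ onGraph′ with OnGraph⇒perfect-power a b gcd≡1 0<r′ 0<s′ onGraph′
  ... | ℓ′ , refl =
    first ℓ′ s′ 0<ℓ′ 0<s′ (^-cancelˡ-< a r′<ℓᵃ) (OnGraph-^⇒OnGraph-1 a b 0<ℓ′ 0<s′ onGraph′)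
    where
    0<ℓ′ : 0 < ℓ′
    0<ℓ′ = m^n>0⇒m>0 ℓ′ a 0<r′

Visible⇒Visible-1-at-root : ∀ a .{{_ : ℕ.NonZero a}} b {r s} → gcd a b ≡ 1 → 0 < r → 0 < s →
                            Visible a b r s → Σ ℕ λ ℓ → 0 < ℓ × r ≡ ℓ ^ a × Visible 1 b ℓ s
Visible⇒Visible-1-at-root a b gcd≡1 0<r 0<s visible@(_ , onGraph , _)
  with OnGraph⇒perfect-power a b gcd≡1 0<r 0<s onGraph
... | ℓ , refl = ℓ , 0<ℓ , refl , Visible-^⇒Visible-1 a b 0<ℓ 0<s visible
  where
  0<ℓ : 0 < ℓ
  0<ℓ = m^n>0⇒m>0 ℓ a 0<r

proposition2 : (a b : ℕ) → 0 < a → 0 < b → gcd a b ≡ 1 →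
    (r s : ℕ) → 0 < r → 0 < s →
    Visible a b r s ⇔
      ((Σ ℚ λ n → OnGraph a b n r s) ×
       (Σ ℕ λ ℓ → 0 < ℓ × r ≡ ℓ ^ a × Visible 1 b ℓ s))
proposition2 a b 0<a _ gcd≡1 r s 0<r 0<s = mk⇔
  (λ visible@(n , onGraph , _) → (n , onGraph) , Visible⇒Visible-1-at-root a b gcd≡1 0<r 0<s visible)
  (λ (_ , ℓ , _ , r≡ℓᵃ , visible) →
     subst (λ r → Visible a b r s) (sym r≡ℓᵃ) (Visible-1⇒Visible-^ a b {ℓ} {s} gcd≡1 visible))
  where
  instance
    a≢0 : ℕ.NonZero a
    a≢0 = ℕ.>-nonZero 0<a
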